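{- For any connected graph $G$: (i) $pd(G\times K_n)\le pd(G)+n-1$ for every $n\ge 1$; (ii) $pd(G\times P_n)\le pd(G)+1$ for every $n\ge 1$; (iii) $pd(G\times C_n)\le pd(G)+2$ for every $n\ge 3$; (iv) $pd(G\times K_{1,n})\le pd(G)+n-1$ for every $n\ge 2$.
   Context: All graphs are finite, simple and connected; $K_n$ is the complete graph on $n$ vertices, $P_n$ the path on $n$ vertices, $C_n$ the cycle on $n$ vertices, and $K_{1,n}$ the star with $n$ leaves. Distance $d(u,v)$ is shortest-path distance and $d(v,P)=\min\{d(v,x):x\in P\}$. For an ordered partition $\Pi=\{P_1,\dots,P_t\}$ of the vertex set, $r(v|\Pi)=(d(v,P_1),\dots,d(v,P_t))$; $\Pi$ is a resolving partition if these vectors are pairwise distinct, and the partition dimension $pd(G)$ is the minimum number of sets in a resolving partition. The Cartesian product $G\times H$ has vertex set $V(G)\times V(H)$, with $(a,b)\sim(c,d)$ iff ($a=c$ and $bd\in E(H)$) or ($b=d$ and $ac\in E(G)$). -}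

module Defs where

open import Level using (0ℓ)
open import Data.Nat using (ℕ; zero; suc; _+_; _≤_; _<_)
open import Data.Fin using (Fin; toℕ) renaming (zero to fzero)
open import Data.Product using (Σ; ∃; _×_; _,_)
open import Data.Sum using (_⊎_)
open import Relation.Nullary using (¬_; Dec)
open import Relation.Binary.PropositionalEquality using (_≡_; _≢_)
open import Function.Bundles using (_↔_)

record Graph : Set₁ where
  field
    V   : Set
    Adj : V → V → Set
open Graph public

data Walk (G : Graph) : V G → V G → ℕ → Set where
  here : ∀ {u} → Walk G u u 0
  step : ∀ {u w v k} → Adj G u w → Walk G w v k → Walk G u v (suc k)

record IsConnectedGraph (G : Graph) : Set where
  field
    size      : ℕ
    finite    : V G ↔ Fin size
    nonempty  : V G
    irrefl    : ∀ v → ¬ Adj G v v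
    symmetric : ∀ {u v} → Adj G u v → Adj G v u
    decAdj    : ∀ u v → Dec (Adj G u v)
    connected : ∀ u v → ∃ λ k → Walk G u v k

Dist : (G : Graph) → V G → V G → ℕ → Set
Dist G u v k = Walk G u v k × (∀ m → Walk G u v m → k ≤ m)

DistSet : (G : Graph) → V G → (V G → Set) → ℕ → Set
DistSet G v P k =
  (∃ λ x → P x × Dist G v x k) × (∀ x m → P x → Dist G v x m → k ≤ m)

-- An ordered partition into t (nonempty) classes P_1..P_t is given by
-- a class map c : V → Fin t that is surjective; P_i = { v | c v ≡ i }.
Class : (G : Graph) {t : ℕ} → (V G → Fin t) → Fin t → V G → Set
Class G c i v = c v ≡ i

IsResolvingPartition : (G : Graph) (t : ℕ) → (V G → Fin t) → Set
IsResolvingPartition G t c =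
  (∀ i → ∃ λ v → c v ≡ i) ×
  (∀ u v → (∀ i k → (DistSet G u (Class G c i) k → DistSet G v (Class G c i) k)
                   × (DistSet G v (Class G c i) k → DistSet G u (Class G c i) k))
         → u ≡ v)

PartitionDimension : Graph → ℕ → Set
PartitionDimension G p =
  (Σ (V G → Fin p) λ c → IsResolvingPartition G p c) ×
  (∀ t (c : V G → Fin t) → IsResolvingPartition G t c → p ≤ t)

_□_ : Graph → Graph → Graph
G □ H = record
  { V   = V G × V H
  ; Adj = λ { (a , b) (c , d) → (a ≡ c × Adj H b d) ⊎ (b ≡ d × Adj G a c) } }

K : ℕ → Graph
K n = record { V = Fin n ; Adj = λ u v → u ≢ v }

P : ℕ → Graph
P n = record { V = Fin n ; Adj = λ u v → (suc (toℕ u) ≡ toℕ v) ⊎ (suc (toℕ v) ≡ toℕ u) }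

-- Cycle C_n on vertices 0..n-1 (used for n ≥ 3): path edges plus the edge {0, n-1}
C : ℕ → Graph
C n = record
  { V = Fin n
  ; Adj = λ u v → (suc (toℕ u) ≡ toℕ v) ⊎ (suc (toℕ v) ≡ toℕ u)
                ⊎ (toℕ u ≡ 0 × suc (toℕ v) ≡ n) ⊎ (toℕ v ≡ 0 × suc (toℕ u) ≡ n) }

Star : ℕ → Graph
Star n = record
  { V = Fin (suc n)
  ; Adj = λ u v → (u ≡ fzero × v ≢ fzero) ⊎ (v ≡ fzero × u ≢ fzero) }

-- Colour (g , h) by the class of g when h lies in the first class of H, and by the
-- class of h otherwise. Distances in G □ H to a "box" S × T split as d(g,S) + d(h,T),
-- so the classes built from H recover all distances of h to the classes of H, hence h;
-- knowing h, the classes built from G recover the distances of g to the classes of G,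
-- hence g. This gives pd(G □ H) ≤ pd(G) + pd(H) − 1, and the four bounds follow from
-- resolving partitions of K_n, P_n, C_n and K_{1,n} with n, 2, 3 and n classes.
module Submission where

open import Defs
open import Data.Nat using (ℕ; zero; suc; _+_; _∸_; _≤_; z≤n; s≤s; _≤?_; _⊓_)
open import Data.Nat.Properties
open import Data.Fin using (Fin; toℕ; fromℕ; inject₁; _↑ˡ_; _↑ʳ_; splitAt) renaming (zero to fzero; suc to fsuc)
open import Data.Fin.Properties using (toℕ-injective; toℕ-fromℕ; toℕ-inject₁; toℕ<n; ↑ˡ-injective; ↑ʳ-injective; splitAt-↑ˡ; splitAt-↑ʳ; splitAt⁻¹-↑ˡ; splitAt⁻¹-↑ʳ) renaming (_≟_ to _≟ᶠ_)
open import Data.Product using (∃; _×_; _,_; proj₁; proj₂)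
open import Data.Sum using (inj₁; inj₂)
open import Data.Unit using (tt)
open import Data.Empty using (⊥-elim)
open import Relation.Nullary using (¬_; yes; no)
open import Relation.Nullary.Decidable using (decidable-stable)
open import Relation.Binary.PropositionalEquality

module _ {X : Graph} where

  _++ʷ_ : ∀ {u w v a b} → Walk X u w a → Walk X w v b → Walk X u v (a + b)
  here ++ʷ q = q
  step e p ++ʷ q = step e (p ++ʷ q)

  walk₀⇒≡ : ∀ {u v} → Walk X u v 0 → u ≡ v
  walk₀⇒≡ here = refl

  distSet-zero : ∀ {T : V X → Set} {h} → T h → DistSet X h T 0
  distSet-zero {h = h} th = (h , th , here , λ _ _ → z≤n) , λ _ _ _ _ → z≤n

  distSet-unique : ∀ {T h a b} → DistSet X h T a → DistSet X h T b → a ≡ b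
  distSet-unique ((x , tx , dx) , ma) ((y , ty , dy) , mb) = ≤-antisym (ma y _ ty dy) (mb x _ tx dx)

  distSet-resp : ∀ {T U : V X → Set} {h k} → (∀ {v} → T v → U v) → (∀ {v} → U v → T v) →
                 DistSet X h T k → DistSet X h U k
  distSet-resp to from ((x , tx , dx) , min) = (x , to tx , dx) , λ y m uy d → min y m (from uy) d

  ¬¬shortest : ∀ {u v} B a → a ≤ B → Walk X u v a → ¬ ¬ (∃ λ j → j ≤ a × Dist X u v j)
  ¬¬shortest zero .zero z≤n w ¬shortest = ¬shortest (0 , z≤n , w , λ _ _ → z≤n)
  ¬¬shortest {u} {v} (suc B) a a≤ w ¬shortest = ¬shortest (a , ≤-refl , w , minimal)
    where
    minimal : ∀ m → Walk X u v m → a ≤ m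
    minimal m w′ with a ≤? m
    ... | yes a≤m = a≤m
    ... | no a≰m = ⊥-elim (¬¬shortest B m (≤-pred (≤-trans (≰⇒> a≰m) a≤)) w′
                     λ { (j , j≤m , d) → ¬shortest (j , ≤-trans j≤m (<⇒≤ (≰⇒> a≰m)) , d) })

  -- DistSet only bounds shortest walks; since _≤_ is decidable, it bounds every walk.
  distSet-≤-walk : ∀ {T h k} → DistSet X h T k → ∀ {x a} → T x → Walk X h x a → k ≤ a
  distSet-≤-walk {k = k} (_ , min) {x} {a} tx w = decidable-stable (k ≤? a)
    λ k≰a → ¬¬shortest a a ≤-refl w λ { (j , j≤a , d) → k≰a (≤-trans (min x j tx d) j≤a) }

  distSet-intro : ∀ {T h x k} → T x → Walk X h x k → (∀ {y m} → T y → Walk X h y m → k ≤ m) →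
                  DistSet X h T k
  distSet-intro tx w lb = (_ , tx , w , λ m w′ → lb tx w′) , λ y m ty d → lb ty (proj₁ d)

  distSet-one : ∀ {T : V X → Set} {h x} → ¬ T h → Adj X h x → T x → DistSet X h T 1
  distSet-one {T} ¬th e tx = distSet-intro tx (step e here) lb
    where
    lb : ∀ {y m} → T y → Walk X _ y m → 1 ≤ m
    lb ty here = ⊥-elim (¬th ty)
    lb ty (step _ _) = s≤s z≤n

  Lipschitz : (V X → ℕ) → Set
  Lipschitz f = ∀ {u w} → Adj X u w → f u ≤ suc (f w)

  lipschitz-walk : ∀ {f} → Lipschitz f → ∀ {u x m} → Walk X u x m → f u ≤ m + f x
  lipschitz-walk L here = ≤-refl
  lipschitz-walk L (step e w) = ≤-trans (L e) (s≤s (lipschitz-walk L w))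

  distSet-lipschitz : ∀ {T : V X → Set} {f} → Lipschitz f → (∀ {x} → T x → f x ≡ 0) →
                      ∀ {h x} → T x → Walk X h x (f h) → DistSet X h T (f h)
  distSet-lipschitz {T} {f} L f≡0 {h} tx w = distSet-intro tx w lb
    where
    lb : ∀ {y m} → T y → Walk X h y m → f h ≤ m
    lb {m = m} ty w′ = subst (f _ ≤_) (trans (cong (m +_) (f≡0 ty)) (+-identityʳ m)) (lipschitz-walk L w′)

SameDistances : (X : Graph) {t : ℕ} → (V X → Fin t) → V X → V X → Set
SameDistances X c u v = ∀ i k → (DistSet X u (Class X c i) k → DistSet X v (Class X c i) k)
                              × (DistSet X v (Class X c i) k → DistSet X u (Class X c i) k)

sameDistances⇒sameClass : ∀ {X t} {c : V X → Fin t} {u v} → SameDistances X c u v → c u ≡ c v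
sameDistances⇒sameClass {X} {c = c} {u} E with proj₁ (E (c u) 0) (distSet-zero {X} refl)
... | (x , cx , w , _) , _ = trans (sym cx) (cong c (sym (walk₀⇒≡ {X} w)))

resolves-by-class-and-distance :
  ∀ {X t} {c : V X → Fin t} {i} (f : V X → ℕ) → (∀ v → DistSet X v (Class X c i) (f v)) →
  (∀ {u v} → c u ≡ c v → f u ≡ f v → u ≡ v) → ∀ u v → SameDistances X c u v → u ≡ v
resolves-by-class-and-distance {X} {i = i} f dist inj u v E =
  inj (sameDistances⇒sameClass {X} E) (distSet-unique {X} (proj₁ (E i (f u)) (dist u)) (dist v))

-- A resolving partition with q + 1 classes, every vertex at finite distance from the
-- first class (H itself need not be connected).
record RootedResolvingPartition (H : Graph) (q : ℕ) : Set where
  field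
    colour    : V H → Fin (suc q)
    resolving : IsResolvingPartition H (suc q) colour
    reachable : ∀ h → ∃ λ k → DistSet H h (Class H colour fzero) k

module _ {G H : Graph} where

  walk-split : ∀ {g h g′ h′ m} → Walk (G □ H) (g , h) (g′ , h′) m →
               ∃ λ a → ∃ λ b → Walk G g g′ a × Walk H h h′ b × a + b ≡ m
  walk-split here = 0 , 0 , here , here , refl
  walk-split (step (inj₁ (refl , e)) w) with walk-split w
  ... | a , b , wg , wh , eq = a , suc b , wg , step e wh , trans (+-suc a b) (cong suc eq)
  walk-split (step (inj₂ (refl , e)) w) with walk-split w
  ... | a , b , wg , wh , eq = suc a , b , step e wg , wh , cong suc eq

  walk-fst : ∀ {g g′ a} (h : V H) → Walk G g g′ a → Walk (G □ H) (g , h) (g′ , h) a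
  walk-fst h here = here
  walk-fst h (step e w) = step (inj₂ (refl , e)) (walk-fst h w)

  walk-snd : ∀ {h h′ b} (g : V G) → Walk H h h′ b → Walk (G □ H) (g , h) (g , h′) b
  walk-snd g here = here
  walk-snd g (step e w) = step (inj₁ (refl , e)) (walk-snd g w)

  walk-pair : ∀ {g g′ h h′ a b} → Walk G g g′ a → Walk H h h′ b → Walk (G □ H) (g , h) (g′ , h′) (a + b)
  walk-pair wg wh = _++ʷ_ {G □ H} (walk-fst _ wg) (walk-snd _ wh)

  Box : (V G → Set) → (V H → Set) → V (G □ H) → Set
  Box S T (g , h) = S g × T h

  distSet-box : ∀ {S T g h a b} → DistSet G g S a → DistSet H h T b →
                DistSet (G □ H) (g , h) (Box S T) (a + b)
  distSet-box {S} {T} {g} {h} {a} {b} dg@((_ , sx , wx , _) , _) dh@((_ , ty , wy , _) , _) =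
    distSet-intro {G □ H} {Box S T} (sx , ty) (walk-pair wx wy) lb
    where
    lb : ∀ {z m} → Box S T z → Walk (G □ H) (g , h) z m → a + b ≤ m
    lb (sx′ , ty′) w with walk-split w
    ... | a′ , b′ , wg , wh , refl = +-mono-≤ (distSet-≤-walk {G} dg sx′ wg) (distSet-≤-walk {H} dh ty′ wh)

  distSet-box⁻¹ : ∀ {S T g h m} → DistSet (G □ H) (g , h) (Box S T) m →
                  ∃ λ a → ∃ λ b → DistSet G g S a × DistSet H h T b × a + b ≡ m
  distSet-box⁻¹ {S} {T} {g} {h} d@((_ , (sx , ty) , w , _) , _) with walk-split w
  ... | a , b , wg , wh , eq = a , b , distSet-intro {G} sx wg lbG , distSet-intro {H} ty wh lbH , eq
    where
    bound : ∀ {z m} → Box S T z → Walk (G □ H) (g , h) z m → a + b ≤ m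
    bound bz w′ = subst (_≤ _) (sym eq) (distSet-≤-walk {G □ H} d bz w′)
    lbG : ∀ {x′ a′} → S x′ → Walk G g x′ a′ → a ≤ a′
    lbG {a′ = a′} sx′ w′ = +-cancelʳ-≤ b a a′ (bound (sx′ , ty) (walk-pair w′ wh))
    lbH : ∀ {y′ b′} → T y′ → Walk H h y′ b′ → b ≤ b′
    lbH {b′ = b′} ty′ w′ = +-cancelˡ-≤ a b b′ (bound (sx , ty′) (walk-pair wg w′))

module ProductPartition {G H : Graph} {p q : ℕ} (g₀ : V G)
         (cG : V G → Fin p) (rG : IsResolvingPartition G p cG)
         (R : RootedResolvingPartition H q) where

  open RootedResolvingPartition R renaming (colour to cH; resolving to rH)

  -- Classes i ↑ˡ q are the boxes (class i of G) × (class 0 of H); classes p ↑ʳ j are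
  -- the boxes V G × (class j + 1 of H).
  combine : Fin p → Fin (suc q) → Fin (p + q)
  combine i fzero = i ↑ˡ q
  combine i (fsuc j) = p ↑ʳ j

  colour : V (G □ H) → Fin (p + q)
  colour (g , h) = combine (cG g) (cH h)

  ↑ʳ≢↑ˡ : ∀ i j → p ↑ʳ j ≢ i ↑ˡ q
  ↑ʳ≢↑ˡ i j e with trans (sym (splitAt-↑ʳ p q j)) (trans (cong (splitAt p) e) (splitAt-↑ˡ p i q))
  ... | ()

  combine≡↑ˡ : ∀ {i c i′} → combine i c ≡ i′ ↑ˡ q → i ≡ i′ × c ≡ fzero
  combine≡↑ˡ {c = fzero} e = ↑ˡ-injective q _ _ e , refl
  combine≡↑ˡ {c = fsuc j} e = ⊥-elim (↑ʳ≢↑ˡ _ j e)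

  combine≡↑ʳ : ∀ {i c j} → combine i c ≡ p ↑ʳ j → c ≡ fsuc j
  combine≡↑ʳ {c = fzero} e = ⊥-elim (↑ʳ≢↑ˡ _ _ (sym e))
  combine≡↑ʳ {c = fsuc j′} e = cong fsuc (↑ʳ-injective p j′ _ e)

  ClassG : Fin p → V G → Set
  ClassG = Class G cG

  ClassH : Fin (suc q) → V H → Set
  ClassH = Class H cH

  Class□ : Fin (p + q) → V (G □ H) → Set
  Class□ = Class (G □ H) colour

  distSet-↑ˡ : ∀ {i g h a b} → DistSet G g (ClassG i) a → DistSet H h (ClassH fzero) b →
               DistSet (G □ H) (g , h) (Class□ (i ↑ˡ q)) (a + b)
  distSet-↑ˡ dg dh = distSet-resp {G □ H} (λ { {g , h} (refl , e) → cong (combine _) e }) combine≡↑ˡ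
                       (distSet-box dg dh)

  distSet-↑ˡ⁻¹ : ∀ {i g h m} → DistSet (G □ H) (g , h) (Class□ (i ↑ˡ q)) m →
                 ∃ λ a → ∃ λ b → DistSet G g (ClassG i) a × DistSet H h (ClassH fzero) b × a + b ≡ m
  distSet-↑ˡ⁻¹ d = distSet-box⁻¹ (distSet-resp {G □ H} combine≡↑ˡ (λ { {g , h} (refl , e) → cong (combine _) e }) d)

  distSet-↑ʳ : ∀ {j g h b} → DistSet H h (ClassH (fsuc j)) b → DistSet (G □ H) (g , h) (Class□ (p ↑ʳ j)) b
  distSet-↑ʳ {g = g} dh = distSet-resp {G □ H} (λ { (_ , e) → cong (combine _) e }) (λ e → tt , combine≡↑ʳ e)
                            (distSet-box (distSet-zero {G} {h = g} tt) dh)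

  distSet-↑ʳ⁻¹ : ∀ {j g h m} → DistSet (G □ H) (g , h) (Class□ (p ↑ʳ j)) m → DistSet H h (ClassH (fsuc j)) m
  distSet-↑ʳ⁻¹ {g = g} {h} d
    with distSet-box⁻¹ (distSet-resp {G □ H} (λ e → tt , combine≡↑ʳ e) (λ { (_ , e) → cong (combine _) e }) d)
  ... | a , b , dg , dh , eq with distSet-unique {G} dg (distSet-zero {G} {h = g} tt)
  ... | refl = subst (DistSet H h _) eq dh

  Transfers : V (G □ H) → V (G □ H) → Set
  Transfers u v = ∀ k m → DistSet (G □ H) u (Class□ k) m → DistSet (G □ H) v (Class□ k) m

  -- As g lies in its own class, the class cG g ↑ˡ q is at distance d(h, class 0) from
  -- (g , h), and at distance at least d(h′, class 0) from any (g′ , h′).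
  distSet-root-≤ : ∀ {g h g′ h′ b b′} → Transfers (g , h) (g′ , h′) →
                   DistSet H h (ClassH fzero) b → DistSet H h′ (ClassH fzero) b′ → b′ ≤ b
  distSet-root-≤ {g} F dh dh′ with distSet-↑ˡ⁻¹ (F (cG g ↑ˡ q) _ (distSet-↑ˡ (distSet-zero {G} refl) dh))
  ... | a , b , _ , dh″ , eq with distSet-unique {H} dh″ dh′
  ... | refl = subst (_ ≤_) eq (m≤n+m _ a)

  transfer-H : ∀ {g h g′ h′} → Transfers (g , h) (g′ , h′) → Transfers (g′ , h′) (g , h) →
               ∀ j k → DistSet H h (ClassH j) k → DistSet H h′ (ClassH j) k
  transfer-H F F′ (fsuc j) k d = distSet-↑ʳ⁻¹ (F (p ↑ʳ j) k (distSet-↑ʳ d))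
  transfer-H {h′ = h′} F F′ fzero k d with reachable h′
  ... | k′ , d′ = subst (DistSet H h′ _) (≤-antisym (distSet-root-≤ F d d′) (distSet-root-≤ F′ d′ d)) d′

  transfer-G : ∀ {g h g′} → Transfers (g , h) (g′ , h) →
               ∀ i k → DistSet G g (ClassG i) k → DistSet G g′ (ClassG i) k
  transfer-G {h = h} F i k d with reachable h
  ... | b , dh with distSet-↑ˡ⁻¹ (F (i ↑ˡ q) _ (distSet-↑ˡ d dh))
  ... | a , b′ , dg′ , dh′ , eq with distSet-unique {H} dh′ dh
  ... | refl = subst (DistSet G _ _) (+-cancelʳ-≡ b a k eq) dg′

  colour-surjective : ∀ k → ∃ λ v → colour v ≡ k
  colour-surjective k with splitAt p k in eq
  ... | inj₁ i with proj₁ rG i | proj₁ rH fzero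
  ...   | g , eg | h , eh = (g , h) , trans (cong₂ combine eg eh) (splitAt⁻¹-↑ˡ eq)
  colour-surjective k | inj₂ j with proj₁ rH (fsuc j)
  ...   | h , eh = (g₀ , h) , trans (cong (combine (cG g₀)) eh) (splitAt⁻¹-↑ʳ eq)

  forward : ∀ {u v} → SameDistances (G □ H) colour u v → Transfers u v
  forward E k m = proj₁ (E k m)

  backward : ∀ {u v} → SameDistances (G □ H) colour u v → Transfers v u
  backward E k m = proj₂ (E k m)

  resolves : ∀ {g h g′ h′} → SameDistances (G □ H) colour (g , h) (g′ , h′) → (g , h) ≡ (g′ , h′)
  resolves {g} {h} {g′} {h′} E
    with proj₂ rH h h′ (λ j k → transfer-H (forward E) (backward E) j k , transfer-H (backward E) (forward E) j k)
  ... | refl = cong (_, h) (proj₂ rG g g′ λ i k → transfer-G (forward E) i k , transfer-G (backward E) i k)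

  resolving : IsResolvingPartition (G □ H) (p + q) colour
  resolving = colour-surjective , λ { (g , h) (g′ , h′) → resolves }

partitionDimension-□-≤ : ∀ {G H p q t} → V G → PartitionDimension G p → RootedResolvingPartition H q →
                         PartitionDimension (G □ H) t → t ≤ p + q
partitionDimension-□-≤ g₀ ((cG , rG) , _) R (_ , minimal) =
  minimal _ _ (ProductPartition.resolving g₀ cG rG R)

single-vertex-partition : ∀ {X} → V X → (∀ u v → u ≡ v) → RootedResolvingPartition X 0
single-vertex-partition {X} x all-equal = record
  { colour    = λ _ → fzero
  ; resolving = (λ { fzero → x , refl }) , λ u v _ → all-equal u v
  ; reachable = λ h → 0 , distSet-zero {X} refl
  }

K-partition : ∀ q → RootedResolvingPartition (K (suc q)) q
K-partition q = record
  { colour    = λ x → x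
  ; resolving = (λ i → i , refl) , λ u v → sameDistances⇒sameClass {K (suc q)}
  ; reachable = reachable
  }
  where
  reachable : ∀ h → ∃ λ k → DistSet (K (suc q)) h (_≡ fzero) k
  reachable h with h ≟ᶠ fzero
  ... | yes h≡0 = 0 , distSet-zero {K (suc q)} h≡0
  ... | no h≢0 = 1 , distSet-one {K (suc q)} h≢0 h≢0 refl

-- The centre shares class 0 with leaf 1; it is told apart from that leaf by its
-- distance 1 to class 1 = {leaf 2}.
module Star-partition (m : ℕ) where

  colour : Fin (3 + m) → Fin (2 + m)
  colour fzero = fzero
  colour (fsuc k) = k

  reachable : ∀ h → ∃ λ k → DistSet (Star (2 + m)) h (Class (Star (2 + m)) colour fzero) k
  reachable fzero = 0 , distSet-zero {Star (2 + m)} refl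
  reachable (fsuc fzero) = 0 , distSet-zero {Star (2 + m)} refl
  reachable (fsuc (fsuc k)) = 1 , distSet-one {Star (2 + m)} (λ ()) (inj₂ (refl , λ ())) refl

  Leaf₂ : Fin (3 + m) → Set
  Leaf₂ = Class (Star (2 + m)) colour (fsuc fzero)

  centre-near-leaf₂ : DistSet (Star (2 + m)) fzero Leaf₂ 1
  centre-near-leaf₂ = distSet-one {Star (2 + m)} {x = fsuc (fsuc fzero)} (λ ()) (inj₁ (refl , λ ())) refl

  leaf₁-far-from-leaf₂ : ¬ DistSet (Star (2 + m)) (fsuc fzero) Leaf₂ 1
  leaf₁-far-from-leaf₂ ((_ , _ , step (inj₁ (() , _)) here , _) , _)
  leaf₁-far-from-leaf₂ ((.fzero , () , step (inj₂ (refl , _)) here , _) , _)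

  resolves : ∀ u v → SameDistances (Star (2 + m)) colour u v → u ≡ v
  resolves u v E with sameDistances⇒sameClass {Star (2 + m)} E
  resolves fzero fzero E | _ = refl
  resolves (fsuc k) (fsuc k′) E | k≡k′ = cong fsuc k≡k′
  resolves fzero (fsuc .fzero) E | refl = ⊥-elim (leaf₁-far-from-leaf₂ (proj₁ (E (fsuc fzero) 1) centre-near-leaf₂))
  resolves (fsuc .fzero) fzero E | refl = ⊥-elim (leaf₁-far-from-leaf₂ (proj₂ (E (fsuc fzero) 1) centre-near-leaf₂))

  partition : RootedResolvingPartition (Star (2 + m)) (suc m)
  partition = record
    { colour = colour ; resolving = (λ i → fsuc i , refl) , resolves ; reachable = reachable }

P-adj-sym : ∀ {N} {u v : Fin N} → Adj (P N) u v → Adj (P N) v u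
P-adj-sym (inj₁ e) = inj₂ e
P-adj-sym (inj₂ e) = inj₁ e

P-walk-reverse : ∀ {N} {u v : Fin N} {k} → Walk (P N) u v k → Walk (P N) v u k
P-walk-reverse here = here
P-walk-reverse {N} (step e w) =
  subst (Walk (P N) _ _) (+-comm _ 1) (_++ʷ_ {P N} (P-walk-reverse w) (step (P-adj-sym e) here))

P-walk-down : ∀ {N} k (b a : Fin N) → toℕ b ≡ k + toℕ a → Walk (P N) b a k
P-walk-down zero b a e = subst (λ z → Walk (P _) b z 0) (toℕ-injective e) here
P-walk-down {suc N} (suc k) (fsuc b) a e =
  step (inj₂ (cong suc (toℕ-inject₁ b))) (P-walk-down k (inject₁ b) a (trans (toℕ-inject₁ b) (suc-injective e)))

P-walk-to-0 : ∀ {N} (b : Fin (suc N)) → Walk (P (suc N)) b fzero (toℕ b)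
P-walk-to-0 b = P-walk-down (toℕ b) b fzero (sym (+-identityʳ _))

P⇒C-walk : ∀ {N} {u v : Fin N} {k} → Walk (P N) u v k → Walk (C N) u v k
P⇒C-walk here = here
P⇒C-walk (step (inj₁ e) w) = step (inj₁ e) (P⇒C-walk w)
P⇒C-walk (step (inj₂ e) w) = step (inj₂ (inj₁ e)) (P⇒C-walk w)

module Path-partition (m : ℕ) where

  colour : Fin (2 + m) → Fin 2
  colour fzero = fzero
  colour (fsuc _) = fsuc fzero

  toℕ-lipschitz : Lipschitz {P (2 + m)} toℕ
  toℕ-lipschitz (inj₁ e) rewrite sym e = ≤-trans (n≤1+n _) (n≤1+n _)
  toℕ-lipschitz (inj₂ e) rewrite sym e = ≤-refl

  distSet-end : ∀ h → DistSet (P (2 + m)) h (Class (P (2 + m)) colour fzero) (toℕ h)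
  distSet-end h = distSet-lipschitz {P (2 + m)} toℕ-lipschitz (λ { {fzero} _ → refl ; {fsuc _} () }) {x = fzero} refl (P-walk-to-0 h)

  partition : RootedResolvingPartition (P (2 + m)) 1
  partition = record
    { colour    = colour
    ; resolving = (λ { fzero → fzero , refl ; (fsuc fzero) → fsuc fzero , refl })
                , resolves-by-class-and-distance {P (2 + m)} toℕ distSet-end (λ _ → toℕ-injective)
    ; reachable = λ h → toℕ h , distSet-end h
    }

m∸n≤1+m∸[1+n] : ∀ m n → m ∸ n ≤ suc (m ∸ suc n)
m∸n≤1+m∸[1+n] zero zero = z≤n
m∸n≤1+m∸[1+n] zero (suc n) = z≤n
m∸n≤1+m∸[1+n] (suc m) zero = ≤-refl
m∸n≤1+m∸[1+n] (suc m) (suc n) = m∸n≤1+m∸[1+n] m n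

-- Classes {0}, {a | 1 ≤ a ≤ N − a} and {a | a > N − a}: the two arcs from 0 to the
-- antipode. On each class the distance min(a, N − a) to vertex 0 determines a.
module Cycle-partition (m : ℕ) where

  N : ℕ
  N = 3 + m

  side : ℕ → Fin 3
  side zero = fzero
  side (suc a) with suc a ≤? N ∸ suc a
  ... | yes _ = fsuc fzero
  ... | no _ = fsuc (fsuc fzero)

  side≡0⇒≡0 : ∀ a → side a ≡ fzero → a ≡ 0
  side≡0⇒≡0 zero _ = refl
  side≡0⇒≡0 (suc a) with suc a ≤? N ∸ suc a
  ... | yes _ = λ ()
  ... | no _ = λ ()

  colour : Fin N → Fin 3
  colour v = side (toℕ v)

  depth : Fin N → ℕ
  depth v = toℕ v ⊓ (N ∸ toℕ v)

  unfold : Fin 3 → ℕ → ℕ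
  unfold fzero _ = 0
  unfold (fsuc fzero) d = d
  unfold (fsuc (fsuc fzero)) d = N ∸ d

  unfold-side : ∀ a → a ≤ N → unfold (side a) (a ⊓ (N ∸ a)) ≡ a
  unfold-side zero _ = refl
  unfold-side (suc a) a≤N with suc a ≤? N ∸ suc a
  ... | yes a≤N∸a = m≤n⇒m⊓n≡m a≤N∸a
  ... | no a≰N∸a = trans (cong (N ∸_) (m≥n⇒m⊓n≡n (<⇒≤ (≰⇒> a≰N∸a)))) (m∸[m∸n]≡n a≤N)

  colour-depth-injective : ∀ {u v} → colour u ≡ colour v → depth u ≡ depth v → u ≡ v
  colour-depth-injective {u} {v} cu≡cv du≡dv = toℕ-injective (begin
    toℕ u                         ≡⟨ sym (unfold-side (toℕ u) (<⇒≤ (toℕ<n u))) ⟩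
    unfold (colour u) (depth u)   ≡⟨ cong₂ unfold cu≡cv du≡dv ⟩
    unfold (colour v) (depth v)   ≡⟨ unfold-side (toℕ v) (<⇒≤ (toℕ<n v)) ⟩
    toℕ v                         ∎)
    where open ≡-Reasoning

  depth-lipschitz : Lipschitz {C N} depth
  depth-lipschitz {u} (inj₁ e) rewrite sym e =
    ⊓-mono-≤ (≤-trans (n≤1+n _) (n≤1+n _)) (m∸n≤1+m∸[1+n] N (toℕ u))
  depth-lipschitz {w = w} (inj₂ (inj₁ e)) rewrite sym e =
    ⊓-mono-≤ ≤-refl (≤-trans (∸-monoʳ-≤ N (n≤1+n (toℕ w))) (n≤1+n _))
  depth-lipschitz (inj₂ (inj₂ (inj₁ (u≡0 , _)))) rewrite u≡0 = z≤n
  depth-lipschitz {u} (inj₂ (inj₂ (inj₂ (w≡0 , 1+u≡N)))) rewrite w≡0 =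
    ≤-trans (m⊓n≤n (toℕ u) (N ∸ toℕ u)) (≤-reflexive (trans (cong (_∸ toℕ u) (sym 1+u≡N)) (m+n∸n≡m 1 (toℕ u))))

  last : Fin N
  last = fromℕ (2 + m)

  walk-to-0 : ∀ h → Walk (C N) h fzero (depth h)
  walk-to-0 h with ⊓-sel (toℕ h) (N ∸ toℕ h)
  ... | inj₁ eq = subst (Walk (C N) h fzero) (sym eq) (P⇒C-walk (P-walk-to-0 h))
  ... | inj₂ eq = subst (Walk (C N) h fzero) (trans length (sym eq))
                    (_++ʷ_ {C N} (P⇒C-walk (P-walk-reverse (P-walk-down (2 + m ∸ toℕ h) last h last≡)))
                                 (step (inj₂ (inj₂ (inj₂ (refl , cong suc (toℕ-fromℕ _))))) here))
    where
    h≤2+m : toℕ h ≤ 2 + m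
    h≤2+m = ≤-pred (toℕ<n h)
    last≡ : toℕ last ≡ (2 + m ∸ toℕ h) + toℕ h
    last≡ = trans (toℕ-fromℕ _) (sym (m∸n+n≡m h≤2+m))
    length : (2 + m ∸ toℕ h) + 1 ≡ N ∸ toℕ h
    length = trans (+-comm (2 + m ∸ toℕ h) 1) (sym (+-∸-assoc 1 h≤2+m))

  distSet-0 : ∀ h → DistSet (C N) h (Class (C N) colour fzero) (depth h)
  distSet-0 h = distSet-lipschitz {C N} depth-lipschitz depth≡0 {x = fzero} refl (walk-to-0 h)
    where
    depth≡0 : ∀ {x} → colour x ≡ fzero → depth x ≡ 0
    depth≡0 {x} e = cong (λ a → a ⊓ (N ∸ a)) (side≡0⇒≡0 (toℕ x) e)

  colour-surjective : ∀ i → ∃ λ v → colour v ≡ i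
  colour-surjective fzero = fzero , refl
  colour-surjective (fsuc fzero) = fsuc fzero , refl
  colour-surjective (fsuc (fsuc fzero)) = last , trans (cong side (toℕ-fromℕ _)) side-last
    where
    side-last : side (2 + m) ≡ fsuc (fsuc fzero)
    side-last with 2 + m ≤? N ∸ (2 + m)
    ... | yes le with ≤-trans le (≤-reflexive (m+n∸n≡m 1 (2 + m)))
    ...   | s≤s ()
    side-last | no _ = refl

  partition : RootedResolvingPartition (C N) 2
  partition = record
    { colour    = colour
    ; resolving = colour-surjective , resolves-by-class-and-distance {C N} depth distSet-0 colour-depth-injective
    ; reachable = λ h → depth h , distSet-0 h
    }

corollary3 : (G : Graph) → IsConnectedGraph G →
    (∀ n → 1 ≤ n → ∀ p q → PartitionDimension G p → PartitionDimension (G □ K n) q → q ≤ p + n ∸ 1)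
    × (∀ n → 1 ≤ n → ∀ p q → PartitionDimension G p → PartitionDimension (G □ P n) q → q ≤ p + 1)
    × (∀ n → 3 ≤ n → ∀ p q → PartitionDimension G p → PartitionDimension (G □ C n) q → q ≤ p + 2)
    × (∀ n → 2 ≤ n → ∀ p q → PartitionDimension G p → PartitionDimension (G □ Star n) q → q ≤ p + n ∸ 1)
corollary3 G connected = complete , path , cycle , star
  where
  g₀ : V G
  g₀ = IsConnectedGraph.nonempty connected

  p+[1+q]∸1≡p+q : ∀ p q → p + suc q ∸ 1 ≡ p + q
  p+[1+q]∸1≡p+q p q = cong (_∸ 1) (+-suc p q)

  complete : ∀ n → 1 ≤ n → ∀ p t → PartitionDimension G p → PartitionDimension (G □ K n) t → t ≤ p + n ∸ 1
  complete (suc q) _ p t pdG pd□ =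
    subst (t ≤_) (sym (p+[1+q]∸1≡p+q p q)) (partitionDimension-□-≤ g₀ pdG (K-partition q) pd□)

  path : ∀ n → 1 ≤ n → ∀ p t → PartitionDimension G p → PartitionDimension (G □ P n) t → t ≤ p + 1
  path 1 _ p t pdG pd□ = ≤-trans
    (partitionDimension-□-≤ g₀ pdG (single-vertex-partition fzero λ { fzero fzero → refl ; (fsuc ()) _ ; _ (fsuc ()) }) pd□)
    (+-monoʳ-≤ p z≤n)
  path (suc (suc m)) _ p t pdG pd□ = partitionDimension-□-≤ g₀ pdG (Path-partition.partition m) pd□

  cycle : ∀ n → 3 ≤ n → ∀ p t → PartitionDimension G p → PartitionDimension (G □ C n) t → t ≤ p + 2
  cycle 1 (s≤s ())
  cycle 2 (s≤s (s≤s ()))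
  cycle (suc (suc (suc m))) _ p t pdG pd□ = partitionDimension-□-≤ g₀ pdG (Cycle-partition.partition m) pd□

  star : ∀ n → 2 ≤ n → ∀ p t → PartitionDimension G p → PartitionDimension (G □ Star n) t → t ≤ p + n ∸ 1
  star 1 (s≤s ())
  star (suc (suc m)) _ p t pdG pd□ =
    subst (t ≤_) (sym (p+[1+q]∸1≡p+q p (suc m))) (partitionDimension-□-≤ g₀ pdG (Star-partition.partition m) pd□)
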